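{- Let $U$ and $V$ be ultrafilters on $\omega$. If $\diamondsuit^-(U)$ and $\diamondsuit^-(V)$ hold, then $\diamondsuit^-(U\cdot V)$ holds.
   Context: $U\cdot V$ is the ultrafilter on $\omega\times\omega$ consisting of all $A\subseteq\omega\times\omega$ such that $\{n\mid\{m\mid(n,m)\in A\}\in V\}\in U$. For an ultrafilter $W$ on a countable set $I$, $\diamondsuit^-(W)$ means: there are $\pi,f:I\to\omega$, a family $\langle\mathcal{A}_i\mid i\in I\rangle$ with $\mathcal{A}_i\subseteq\mathcal{P}(f(i))$ (where $f(i)=\{0,\dots,f(i)-1\}$) and $|\mathcal{A}_i|\le\pi(i)$, and $T\subseteq\mathcal{P}(\omega)$ with $|T|=\mathfrak{c}$, such that for every $h:\omega\to\omega$, $\{i\in I\mid h(\pi(i))<f(i)\}\in W$, and for every $X\in T$, $\{i\in I\mid X\cap f(i)\in\mathcal{A}_i\}\in W$. -}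

module Defs where

open import Data.Nat using (ℕ; _<_; _≤_)
open import Data.Bool using (Bool; true; false; not; _∧_)
open import Data.Fin using (Fin; toℕ)
open import Data.List using (List; length)
open import Data.List.Relation.Unary.Any using (Any)
open import Data.Product using (Σ; _×_; _,_; ∃)
open import Relation.Binary.PropositionalEquality using (_≡_)

-- An ultrafilter on I is represented by its (two-valued) membership
-- function W : P(I) → Bool, with W A ≡ true meaning A ∈ W.
Subset : Set → Set
Subset I = I → Bool

record IsUltrafilter {I : Set} (W : Subset I → Bool) : Set where
  field
    whole    : W (λ _ → true) ≡ true
    proper   : W (λ _ → false) ≡ false
    upward   : ∀ (A B : Subset I) → (∀ i → A i ≡ true → B i ≡ true) →
               W A ≡ true → W B ≡ true
    meet     : ∀ (A B : Subset I) → W A ≡ true → W B ≡ true →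
               W (λ i → A i ∧ B i) ≡ true
    ultra    : ∀ (A : Subset I) → W A ≡ false → W (λ i → not (A i)) ≡ true

-- "{ i ∈ I | S i } ∈ W" for an arbitrary (not necessarily Bool-valued)
-- property S: some member of W is contained in { i | S i }.
-- For an ultrafilter (upward closed) this is exactly membership.
InW : {I : Set} → (Subset I → Bool) → (I → Set) → Set
InW {I} W S = Σ (Subset I) λ A → (W A ≡ true) × (∀ i → A i ≡ true → S i)

_·_ : (Subset ℕ → Bool) → (Subset ℕ → Bool) → Subset (ℕ × ℕ) → Bool
(U · V) A = U (λ n → V (λ m → A (n , m)))

-- X ∩ f(i) as a subset of {0,…,f(i)-1}, represented as Fin (f i) → Bool.
restrict : (X : Subset ℕ) (k : ℕ) → Fin k → Bool
restrict X k j = X (toℕ j)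

_∈fam_ : {k : ℕ} → (Fin k → Bool) → List (Fin k → Bool) → Set
_∈fam_ {k} Y 𝒜 = Any (λ Z → ∀ j → Z j ≡ Y j) 𝒜

-- The family T ⊆ P(ω) with |T| = 𝔠 is given as the image of an injective
-- map t : P(ω) → P(ω) (injective w.r.t. extensional equality of subsets).
DiamondMinus : {I : Set} → (Subset I → Bool) → Set
DiamondMinus {I} W =
  Σ (I → ℕ) λ π →
  Σ (I → ℕ) λ f →
  Σ ((i : I) → List (Fin (f i) → Bool)) λ 𝒜 →
  Σ (Subset ℕ → Subset ℕ) λ t →
    (∀ i → length (𝒜 i) ≤ π i)
  × (∀ (a b : Subset ℕ) → (∀ n → t a n ≡ t b n) → ∀ n → a n ≡ b n)
  × (∀ (h : ℕ → ℕ) → InW W (λ i → h (π i) < f i))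
  × (∀ (a : Subset ℕ) → InW W (λ i → restrict (t a) (f i) ∈fam 𝒜 i))

-- ◇⁻ transfers along Rudin–Keisler projections: if g maps W onto V, the
-- witnesses for ◇⁻(V) composed with g witness ◇⁻(W).  The second projection
-- maps U · V onto V, so ◇⁻(V) alone already gives ◇⁻(U · V).
module Submission where

open import Defs
open import Data.Nat using (ℕ)
open import Data.Bool using (Bool; true)
open import Data.Product using (_,_; proj₂)
open import Function using (_∘_)
open import Relation.Binary.PropositionalEquality using (_≡_; subst; sym)

ImageContains : {I J : Set} → (Subset I → Bool) → (I → J) → (Subset J → Bool) → Set
ImageContains W g V = ∀ B → V B ≡ true → W (B ∘ g) ≡ true

InW-comap : {I J : Set} {W : Subset I → Bool} {V : Subset J → Bool} (g : I → J) →
            ImageContains W g V → (S : J → Set) → InW V S → InW W (S ∘ g)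
InW-comap g W⊇gV S (B , B∈V , B⊆S) = B ∘ g , W⊇gV B B∈V , B⊆S ∘ g

DiamondMinus-comap : {I J : Set} {W : Subset I → Bool} {V : Subset J → Bool} (g : I → J) →
                     ImageContains W g V → DiamondMinus V → DiamondMinus W
DiamondMinus-comap g W⊇gV (π , f , 𝒜 , t , |𝒜|≤π , t-injective , f-dominates , t-guessed) =
  π ∘ g , f ∘ g , 𝒜 ∘ g , t , |𝒜|≤π ∘ g , t-injective ,
  (λ h → InW-comap g W⊇gV _ (f-dominates h)) ,
  (λ a → InW-comap g W⊇gV _ (t-guessed a))

·-imageContains-proj₂ : (U V : Subset ℕ → Bool) → IsUltrafilter U →
                        ImageContains (U · V) proj₂ V
·-imageContains-proj₂ U V U-ultra B B∈V =
  subst (λ b → U (λ _ → b) ≡ true) (sym B∈V) (IsUltrafilter.whole U-ultra)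

mainTheorem18 : (U V : Subset ℕ → Bool) → IsUltrafilter U → IsUltrafilter V →
                DiamondMinus U → DiamondMinus V → DiamondMinus (U · V)
mainTheorem18 U V U-ultra _ _ =
  DiamondMinus-comap proj₂ (·-imageContains-proj₂ U V U-ultra)
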